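{- Let $n\ge1$ and let $\Theta\subseteq E(\widetilde K^n)^2$ be any subset. Then $$\mathrm{Sol}_{\mathbb K}(\Theta)=\mathrm{Sol}_{\mathbb M}(u_n^2(\Theta))\cap\{0,\tfrac12,1\}^n.$$
   Context: $K=\{0,\tfrac12,1\}$ is the Kleene chain ($0<\tfrac12<1$, $\neg 0=1$, $\neg\tfrac12=\tfrac12$). $E(\widetilde K^n)$ denotes the free Kleene algebra on $n$ generators, realized as the Kleene algebra (pointwise operations from $K$) of functions $\{0,\tfrac12,1\}^n\to\{0,\tfrac12,1\}$ generated by the projections $\rho_1,\dots,\rho_n$ together with constants; the $\rho_i$ are free generators. $\mathcal M_n$ denotes the MV-algebra of $\mathbb Z$-maps $[0,1]^n\to[0,1]$ (continuous piecewise linear functions with finitely many affine pieces, each with integer coefficients), with pointwise operations $f\oplus g=\min\{f+g,1\}$, $\neg f=1-f$; its underlying Kleene algebra has $\vee=\max$, $\wedge=\min$, $\neg f=1-f$, constants $0,1$. $u_n\colon E(\widetilde K^n)\to\mathcal M_n$ is the unique Kleene algebra homomorphism with $u_n(\rho_i)=\pi_i$ (the $i$-th coordinate projection on $[0,1]^n$), and $u_n^2(\Theta)=\{(u_n(f),u_n(g)):(f,g)\in\Theta\}$. For $\Theta\subseteq E(\widetilde K^n)^2$, $\mathrm{Sol}_{\mathbb K}(\Theta)=\{v\in\{0,\tfrac12,1\}^n: f(v)=g(v)\ \forall (f,g)\in\Theta\}$; for $\Phi\subseteq\mathcal M_n^2$, $\mathrm{Sol}_{\mathbb M}(\Phi)=\{v\in[0,1]^n: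 f(v)=g(v)\ \forall(f,g)\in\Phi\}$.
   Formalization: The Z-maps of $\mathcal M_n$ are represented by functions on ℚ^n, and $\mathrm{Sol}_{\mathbb M}$ is taken over the rational points of $[0,1]^n$ rather than all its real points. -}

module Defs where

open import Data.Nat using (ℕ)
open import Data.Fin using (Fin)
open import Data.Product using (Σ; Σ-syntax; ∃; _×_; _,_; proj₁)
open import Data.Rational using (ℚ; 0ℚ; 1ℚ; ½; _⊔_; _⊓_; _-_; _≤_)
open import Relation.Binary.PropositionalEquality using (_≡_)
open import Relation.Unary using (Pred)
open import Level using (0ℓ)

data K : Set where
  k0 kh k1 : K

_∧K_ : K → K → K
k0 ∧K _ = k0
kh ∧K k0 = k0
kh ∧K _ = kh
k1 ∧K y = y

_∨K_ : K → K → K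
k0 ∨K y = y
kh ∨K k1 = k1
kh ∨K _ = kh
k1 ∨K _ = k1

¬K_ : K → K
¬K k0 = k1
¬K kh = kh
¬K k1 = k0

data Term (n : ℕ) : Set where
  var : Fin n → Term n
  ⊥t ⊤t : Term n
  _∧t_ _∨t_ : Term n → Term n → Term n
  ¬t_ : Term n → Term n

⟦_⟧K : ∀ {n} → Term n → (Fin n → K) → K
⟦ var i ⟧K v = v i
⟦ ⊥t ⟧K v = k0
⟦ ⊤t ⟧K v = k1
⟦ s ∧t t ⟧K v = ⟦ s ⟧K v ∧K ⟦ t ⟧K v
⟦ s ∨t t ⟧K v = ⟦ s ⟧K v ∨K ⟦ t ⟧K v
⟦ ¬t t ⟧K v = ¬K (⟦ t ⟧K v)

-- E(K̃^n): functions K^n → K generated by projections ρ_i and constants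
-- under the pointwise Kleene operations; each element carries a generating term.
E : ℕ → Set
E n = Σ[ f ∈ ((Fin n → K) → K) ] Σ[ t ∈ Term n ] (∀ v → ⟦ t ⟧K v ≡ f v)

fun : ∀ {n} → E n → (Fin n → K) → K
fun = proj₁

-- Functions ℚ^n → ℚ; the Z-maps of M_n are considered through their values
-- at rational points of [0,1]^n.
M : ℕ → Set
M n = (Fin n → ℚ) → ℚ

⟦_⟧M : ∀ {n} → Term n → M n
⟦ var i ⟧M w = w i
⟦ ⊥t ⟧M w = 0ℚ
⟦ ⊤t ⟧M w = 1ℚ
⟦ s ∧t t ⟧M w = ⟦ s ⟧M w ⊓ ⟦ t ⟧M w
⟦ s ∨t t ⟧M w = ⟦ s ⟧M w ⊔ ⟦ t ⟧M w
⟦ ¬t t ⟧M w = 1ℚ - ⟦ t ⟧M w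

u : ∀ {n} → E n → M n
u (f , t , _) = ⟦ t ⟧M

u² : ∀ {n} → Pred (E n × E n) 0ℓ → Pred (M n × M n) 0ℓ
u² Θ (F , G) = Σ[ p ∈ _ × _ ] (Θ p × (F ≡ u (Data.Product.proj₁ p) × G ≡ u (Data.Product.proj₂ p)))

SolK : ∀ {n} → Pred (E n × E n) 0ℓ → Pred (Fin n → K) 0ℓ
SolK Θ v = ∀ f g → Θ (f , g) → fun f v ≡ fun g v

SolM : ∀ {n} → Pred (M n × M n) 0ℓ → Pred (Fin n → ℚ) 0ℓ
SolM Φ w = (∀ i → (0ℚ ≤ w i) × (w i ≤ 1ℚ)) × (∀ F G → Φ (F , G) → F w ≡ G w)

ι : K → ℚ
ι k0 = 0ℚ
ι kh = ½
ι k1 = 1ℚ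

InK : ∀ {n} → Pred (Fin n → ℚ) 0ℓ
InK {n} w = Σ[ v ∈ (Fin n → K) ] (∀ i → ι (v i) ≡ w i)

SolK↑ : ∀ {n} → Pred (E n × E n) 0ℓ → Pred (Fin n → ℚ) 0ℓ
SolK↑ {n} Θ w = Σ[ v ∈ (Fin n → K) ] ((∀ i → ι (v i) ≡ w i) × SolK Θ v)

module Submission where

-- The inclusion ι : K → [0,1] is an injective homomorphism of Kleene algebras,
-- so evaluating a term in [0,1] at ι ∘ v gives ι of its value in K at v. An
-- equation f = g therefore holds at v ∈ K^n exactly when u f = u g holds at ι ∘ v.

open import Defs
open import Data.Nat using (ℕ; _≤_)
open import Data.Fin using (Fin)
open import Data.Product using (_×_; _,_)
open import Data.Rational using (ℚ; 0ℚ; 1ℚ; _⊔_; _⊓_; _-_; _≤?_) renaming (_≤_ to _≤ℚ_)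
open import Data.Unit using (tt)
open import Function.Bundles using (_⇔_; mk⇔; Equivalence)
open import Function.Definitions using (Injective)
open import Relation.Nullary.Decidable using (True; toWitness)
open import Relation.Unary using (Pred)
open import Relation.Binary.PropositionalEquality
open import Level using (0ℓ)

ι-∧ : ∀ a b → ι a ⊓ ι b ≡ ι (a ∧K b)
ι-∧ k0 k0 = refl
ι-∧ k0 kh = refl
ι-∧ k0 k1 = refl
ι-∧ kh k0 = refl
ι-∧ kh kh = refl
ι-∧ kh k1 = refl
ι-∧ k1 k0 = refl
ι-∧ k1 kh = refl
ι-∧ k1 k1 = refl

ι-∨ : ∀ a b → ι a ⊔ ι b ≡ ι (a ∨K b)
ι-∨ k0 k0 = refl
ι-∨ k0 kh = refl
ι-∨ k0 k1 = refl
ι-∨ kh k0 = refl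
ι-∨ kh kh = refl
ι-∨ kh k1 = refl
ι-∨ k1 k0 = refl
ι-∨ k1 kh = refl
ι-∨ k1 k1 = refl

ι-¬ : ∀ a → 1ℚ - ι a ≡ ι (¬K a)
ι-¬ k0 = refl
ι-¬ kh = refl
ι-¬ k1 = refl

ι-injective : Injective _≡_ _≡_ ι
ι-injective {k0} {k0} _ = refl
ι-injective {kh} {kh} _ = refl
ι-injective {k1} {k1} _ = refl
ι-injective {k0} {kh} ()
ι-injective {k0} {k1} ()
ι-injective {kh} {k0} ()
ι-injective {kh} {k1} ()
ι-injective {k1} {k0} ()
ι-injective {k1} {kh} ()

ι-∈[0,1] : ∀ a → (0ℚ ≤ℚ ι a) × (ι a ≤ℚ 1ℚ)
ι-∈[0,1] a = toWitness {a? = 0ℚ ≤? ι a} (lower a) , toWitness {a? = ι a ≤? 1ℚ} (upper a)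
  where
  lower : ∀ a → True (0ℚ ≤? ι a)
  lower k0 = tt
  lower kh = tt
  lower k1 = tt
  upper : ∀ a → True (ι a ≤? 1ℚ)
  upper k0 = tt
  upper kh = tt
  upper k1 = tt

module _ {n : ℕ} (v : Fin n → K) (w : Fin n → ℚ) (w≡ι∘v : ∀ i → ι (v i) ≡ w i) where

  ⟦⟧M-ι : ∀ (t : Term n) → ⟦ t ⟧M w ≡ ι (⟦ t ⟧K v)
  ⟦⟧M-ι (var i) = sym (w≡ι∘v i)
  ⟦⟧M-ι ⊥t = refl
  ⟦⟧M-ι ⊤t = refl
  ⟦⟧M-ι (s ∧t t) = trans (cong₂ _⊓_ (⟦⟧M-ι s) (⟦⟧M-ι t)) (ι-∧ (⟦ s ⟧K v) (⟦ t ⟧K v))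
  ⟦⟧M-ι (s ∨t t) = trans (cong₂ _⊔_ (⟦⟧M-ι s) (⟦⟧M-ι t)) (ι-∨ (⟦ s ⟧K v) (⟦ t ⟧K v))
  ⟦⟧M-ι (¬t t) = trans (cong (1ℚ -_) (⟦⟧M-ι t)) (ι-¬ (⟦ t ⟧K v))

  u-ι : ∀ (f : E n) → u f w ≡ ι (fun f v)
  u-ι (_ , t , ⟦t⟧K≗f) = trans (⟦⟧M-ι t) (cong ι (⟦t⟧K≗f v))

  u-≡⇔fun-≡ : ∀ (f g : E n) → (u f w ≡ u g w) ⇔ (fun f v ≡ fun g v)
  u-≡⇔fun-≡ f g = mk⇔
    (λ uf≡ug → ι-injective (trans (sym (u-ι f)) (trans uf≡ug (u-ι g))))
    (λ f≡g → trans (u-ι f) (trans (cong ι f≡g) (sym (u-ι g))))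

  SolK⇒SolM-u² : ∀ (Θ : Pred (E n × E n) 0ℓ) → SolK Θ v → SolM (u² Θ) w
  SolK⇒SolM-u² Θ sol =
    in[0,1] , λ { _ _ ((f , g) , θ , refl , refl) → Equivalence.from (u-≡⇔fun-≡ f g) (sol f g θ) }
    where
    in[0,1] : ∀ i → (0ℚ ≤ℚ w i) × (w i ≤ℚ 1ℚ)
    in[0,1] i = subst (λ q → (0ℚ ≤ℚ q) × (q ≤ℚ 1ℚ)) (w≡ι∘v i) (ι-∈[0,1] (v i))

  SolM-u²⇒SolK : ∀ (Θ : Pred (E n × E n) 0ℓ) → SolM (u² Θ) w → SolK Θ v
  SolM-u²⇒SolK Θ (_ , sol) f g θ = Equivalence.to (u-≡⇔fun-≡ f g) (sol (u f) (u g) ((f , g) , θ , refl , refl))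

-- The argument does not need n ≥ 1.
lemma3p4 : (n : ℕ) → 1 ≤ n → (Θ : Pred (E n × E n) 0ℓ) → (w : Fin n → ℚ)
    → (SolK↑ Θ w → SolM (u² Θ) w × InK w) × (SolM (u² Θ) w × InK w → SolK↑ Θ w)
lemma3p4 n _ Θ w =
  (λ { (v , w≡ι∘v , sol) → SolK⇒SolM-u² v w w≡ι∘v Θ sol , (v , w≡ι∘v) }) ,
  (λ { (sol , (v , w≡ι∘v)) → v , w≡ι∘v , SolM-u²⇒SolK v w w≡ι∘v Θ sol })
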